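{- The pattern $P_{\emptyset}$ can be detected in linear time, i.e. given an ordered graph $(G,\tau)$ with $n$ vertices and $m$ edges (by adjacency lists), one can decide in time $O(n+m)$ whether it contains $P_\emptyset$.
   Context: $P_\emptyset$ is the pattern on vertices $1<2<3<4$ in which $\{1,3\}$ and $\{2,4\}$ are mandatory edges and all other pairs are undecided. An ordered graph $(G,\tau)$ contains $P_\emptyset$ if there are vertices $x_1<_\tau x_2<_\tau x_3<_\tau x_4$ with $x_1x_3, x_2x_4\in E(G)$. -}

module Defs where

open import Data.Nat using (ℕ; zero; suc; _+_; _*_; _∸_; _<_; _≤_)
open import Data.Nat.Properties using (_≟_)
open import Data.Fin using (Fin; toℕ)
open import Data.Vec using (Vec; lookup; toList)
open import Data.List using (List; []; _∷_; length; map; _++_; concat; scanl)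
open import Data.Nat.ListAction using (sum)
open import Data.List.Membership.Propositional using (_∈_)
open import Data.List.Relation.Unary.Unique.Propositional using (Unique)
open import Data.Product using (Σ; ∃; _×_; _,_)
open import Data.Sum using (_⊎_)
open import Relation.Binary.PropositionalEquality using (_≡_)
open import Relation.Nullary using (¬_; yes; no)

-- The vertices are 0,…,n-1 (Fin n); the vertex order τ is the natural
-- order of Fin n (i.e. vertices are named by their τ-rank).
-- adj i is the adjacency list of vertex i.

record OrderedGraph : Set where
  field
    n      : ℕ
    adj    : Vec (List (Fin n)) n
    noLoop : ∀ i → ¬ (i ∈ lookup adj i)
    nodup  : ∀ i → Unique (lookup adj i)
    symm   : ∀ i j → j ∈ lookup adj i → i ∈ lookup adj j

open OrderedGraph public

Edge : (G : OrderedGraph) → Fin (n G) → Fin (n G) → Set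
Edge G i j = j ∈ lookup (adj G) i

-- total length of all adjacency lists (= 2m, m the number of edges)
adjSize : OrderedGraph → ℕ
adjSize G = sum (map length (toList (adj G)))

ContainsP∅ : OrderedGraph → Set
ContainsP∅ G = Σ (Fin (n G)) λ x1 → Σ (Fin (n G)) λ x2 →
               Σ (Fin (n G)) λ x3 → Σ (Fin (n G)) λ x4 →
               (toℕ x1 < toℕ x2) × (toℕ x2 < toℕ x3) × (toℕ x3 < toℕ x4) ×
               Edge G x1 x3 × Edge G x2 x4

-- Model of computation: a unit-cost RAM (memory ℕ → ℕ, addition and
-- truncated subtraction, direct and indirect addressing, conditional jump).

data Instr : Set where
  const : (a k : ℕ) → Instr          -- M[a] := k
  add   : (a b c : ℕ) → Instr        -- M[a] := M[b] + M[c]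
  sub   : (a b c : ℕ) → Instr        -- M[a] := M[b] ∸ M[c]
  load  : (a b : ℕ) → Instr          -- M[a] := M[M[b]]
  store : (a b : ℕ) → Instr          -- M[M[a]] := M[b]
  jz    : (a t : ℕ) → Instr          -- if M[a] = 0 then pc := t else pc := pc+1
  halt  : Instr

Program : Set
Program = List Instr

Memory : Set
Memory = ℕ → ℕ

record Config : Set where
  constructor cfg
  field
    pc  : ℕ
    mem : Memory

open Config public

-- instruction at a position; outside the program the machine halts
fetch : Program → ℕ → Instr
fetch []      _       = halt
fetch (i ∷ p) zero    = i
fetch (i ∷ p) (suc k) = fetch p k

write : Memory → ℕ → ℕ → Memory
write M a v x with x ≟ a
... | yes _ = v
... | no  _ = M x

step : Program → Config → Config
step P (cfg p M) with fetch P p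
... | const a k   = cfg (suc p) (write M a k)
... | add a b c   = cfg (suc p) (write M a (M b + M c))
... | sub a b c   = cfg (suc p) (write M a (M b ∸ M c))
... | load a b    = cfg (suc p) (write M a (M (M b)))
... | store a b   = cfg (suc p) (write M (M a) (M b))
... | jz a t with M a
...   | zero  = cfg t M
...   | suc _ = cfg (suc p) M
step P (cfg p M) | halt = cfg p M

run : Program → ℕ → Config → Config
run P zero    c = c
run P (suc t) c = run P t (step P c)

Halted : Program → Config → Set
Halted P c = fetch P (pc c) ≡ halt

-- Input encoding (compressed adjacency lists), as a list of words
-- placed at addresses 0,1,2,…, all other cells 0:
--   address 0           : n
--   addresses 1 … n+1   : offsets o_0 ≤ … ≤ o_n, list of vertex i occupies
--                         addresses n+2+o_i , … , n+2+o_{i+1}-1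
--   addresses n+2 …     : the concatenated adjacency lists (vertex i ↦ i)

listAt : List ℕ → Memory
listAt []       _       = 0
listAt (v ∷ vs) zero    = v
listAt (v ∷ vs) (suc a) = listAt vs a

encodeList : OrderedGraph → List ℕ
encodeList G =
  n G ∷ (scanl _+_ 0 (map length lists) ++ concat (map (map toℕ) lists))
  where lists = toList (adj G)

initial : OrderedGraph → Config
initial G = cfg 0 (listAt (encodeList G))

DecidesWithin : Program → (c d : ℕ) → Set
DecidesWithin P c d = ∀ (G : OrderedGraph) →
  Σ ℕ λ t → (t ≤ c * (n G + adjSize G) + d) ×
    Halted P (run P t (initial G)) ×
    ((mem (run P t (initial G)) 0 ≡ 1 × ContainsP∅ G) ⊎
     (mem (run P t (initial G)) 0 ≡ 0 × ¬ ContainsP∅ G))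

{-# OPTIONS --safe #-}
module Submission where

open import Defs
open import Algebra.Definitions using (Selective)
open import Data.Bool using (true; false; if_then_else_; T)
open import Data.Fin using (Fin; toℕ; fromℕ<) renaming (zero to fzero; suc to fsuc)
open import Data.Fin.Properties using (toℕ<n; toℕ-fromℕ<)
open import Data.List using (List; []; _∷_; length; map; foldl; concat; drop; scanl; _++_)
open import Data.List.Membership.Propositional using (_∈_)
open import Data.List.Membership.Propositional.Properties using (∈-map⁺; ∈-map⁻)
open import Data.List.Properties using (length-map; length-++; map-∘; map-cong)
open import Data.List.Relation.Unary.All using (All; []) renaming (lookup to lookupAll)
open import Data.List.Relation.Unary.Any using (here; there)
open import Data.List.Relation.Unary.Linked as Linked using (Linked; [-]; _∷_)
open import Data.List.Relation.Unary.Linked.Properties using (Linked⇒All)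
open import Data.Nat
open import Data.Nat.ListAction using (sum)
open import Data.Nat.Properties
open import Data.Nat.Solver using (module +-*-Solver)
open import Data.Product using (Σ; ∃; ∃₂; _×_; _,_; proj₁; proj₂)
open import Data.Sum using (_⊎_; inj₁; inj₂)
open import Data.Unit using (⊤; tt)
open import Data.Vec using (Vec; []; _∷_; toList; lookup)
open import Data.Vec.Properties using (length-toList)
open import Function using (_∘_)
open import Level using (0ℓ)
open import Relation.Binary using (Rel)
open import Relation.Binary.PropositionalEquality
open import Relation.Nullary using (¬_; yes; no; contradiction)

open +-*-Solver using (solve; _:+_; _:*_; _:=_; con)

-- Write low c and high b for the least vertex among c and its neighbours and the largest among b and its
-- neighbours.  An occurrence x₁ < x₂ < x₃ < x₄ of P∅ gives low x₃ < x₂ < x₃ < high x₂, and conversely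
-- low c < b < c < high b exhibits one, so P∅ occurs iff some pair b < c crosses in this sense.
-- Scanning c upwards, keep a stack of earlier vertices, decreasing from the top.  While the top b exceeds
-- low c, either c < high b and (b, c) crosses, or high b ≤ c and b can never cross again, so it is popped;
-- once the top is at most low c, so is every vertex below it, and c is pushed.  Every vertex is pushed and
-- popped at most once, so after computing low and high from the adjacency lists the scan takes linear
-- time; charging 11 steps to each stack entry turns this into an explicit bound for the RAM program below.

-- Crossing pairs

module _ {A : Set} {_•_ : A → A → A} where

  foldl-selective : Selective _≡_ _•_ → ∀ a xs → foldl _•_ a xs ≡ a ⊎ foldl _•_ a xs ∈ xs
  foldl-selective sel a []       = inj₁ refl
  foldl-selective sel a (y ∷ ys) with foldl-selective sel (a • y) ys
  ... | inj₂ ∈ys = inj₂ (there ∈ys)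
  ... | inj₁ ≡a•y with sel a y
  ...   | inj₁ a•y≡a = inj₁ (trans ≡a•y a•y≡a)
  ...   | inj₂ a•y≡y = inj₂ (here (trans ≡a•y a•y≡y))

module _ {A : Set} (_≼_ : Rel A 0ℓ) (≼-refl : ∀ {x} → x ≼ x) (≼-trans : ∀ {x y z} → x ≼ y → y ≼ z → x ≼ z)
         {_•_ : A → A → A} (•-≼ˡ : ∀ x y → (x • y) ≼ x) (•-≼ʳ : ∀ x y → (x • y) ≼ y) where

  foldl-≼-init : ∀ a xs → foldl _•_ a xs ≼ a
  foldl-≼-init a []       = ≼-refl
  foldl-≼-init a (y ∷ ys) = ≼-trans (foldl-≼-init (a • y) ys) (•-≼ˡ a y)

  foldl-≼-∈ : ∀ a {x} xs → x ∈ xs → foldl _•_ a xs ≼ x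
  foldl-≼-∈ a (y ∷ ys) (here refl)  = ≼-trans (foldl-≼-init (a • y) ys) (•-≼ʳ a y)
  foldl-≼-∈ a (y ∷ ys) (there x∈ys) = foldl-≼-∈ (a • y) ys x∈ys

foldl-⊓-≤-∈ : ∀ a {x} xs → x ∈ xs → foldl _⊓_ a xs ≤ x
foldl-⊓-≤-∈ = foldl-≼-∈ _≤_ ≤-refl ≤-trans m⊓n≤m m⊓n≤n

foldl-⊔-≥-∈ : ∀ a {x} xs → x ∈ xs → x ≤ foldl _⊔_ a xs
foldl-⊔-≥-∈ = foldl-≼-∈ _≥_ ≤-refl (λ y≤x z≤y → ≤-trans z≤y y≤x) m≤m⊔n m≤n⊔m

nth : {A : Set} → List (List A) → ℕ → List A
nth []       _       = []
nth (l ∷ _)  zero    = l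
nth (_ ∷ ls) (suc i) = nth ls i

module Crossings (Ls : List (List ℕ)) where

  low : ℕ → ℕ
  low c = foldl _⊓_ c (nth Ls c)

  high : ℕ → ℕ
  high b = foldl _⊔_ b (nth Ls b)

  Crossing : ℕ → ℕ → Set
  Crossing b c = b < c × low c < b × c < high b

  HasCrossing : Set
  HasCrossing = ∃₂ λ b c → c < length Ls × Crossing b c

  NoCrossingBefore : ℕ → Set
  NoCrossingBefore c = ∀ b {c′} → c′ < c → ¬ Crossing b c′

  low-∈ : ∀ {c} → low c < c → low c ∈ nth Ls c
  low-∈ {c} low<c with foldl-selective ⊓-sel c (nth Ls c)
  ... | inj₁ low≡c = contradiction low≡c (<⇒≢ low<c)
  ... | inj₂ low∈  = low∈

  high-∈ : ∀ {b} → b < high b → high b ∈ nth Ls b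
  high-∈ {b} b<high with foldl-selective ⊔-sel b (nth Ls b)
  ... | inj₁ high≡b = contradiction (sym high≡b) (<⇒≢ b<high)
  ... | inj₂ high∈  = high∈

  Alive : ℕ → List ℕ → Set
  Alive c stack = ∀ {b} → b < c → b ∈ stack ⊎ high b ≤ c

  Descending : ℕ → List ℕ → Set
  Descending c stack = Linked _>_ (c ∷ stack)

  alive-pop : ∀ {c b bs} → Alive c (b ∷ bs) → high b ≤ c → Alive c bs
  alive-pop alive high≤c b′<c with alive b′<c
  ... | inj₁ (here refl)   = inj₂ high≤c
  ... | inj₁ (there b′∈bs) = inj₁ b′∈bs
  ... | inj₂ high′≤c       = inj₂ high′≤c

  alive-push : ∀ {c stack} → Alive c stack → Alive (suc c) (c ∷ stack)
  alive-push alive b<1+c with m<1+n⇒m<n∨m≡n b<1+c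
  ... | inj₂ refl = inj₁ (here refl)
  ... | inj₁ b<c with alive b<c
  ...   | inj₁ b∈stack = inj₁ (there b∈stack)
  ...   | inj₂ high≤c  = inj₂ (m≤n⇒m≤1+n high≤c)

  descending-pop : ∀ {c b bs} → Descending c (b ∷ bs) → Descending c bs
  descending-pop (c>b ∷ [-])           = [-]
  descending-pop (c>b ∷ b>b′ ∷ linked) = <-trans b>b′ c>b ∷ linked

  descending-push : ∀ {c stack} → Descending c stack → Descending (suc c) (c ∷ stack)
  descending-push desc = n<1+n _ ∷ desc

  descending-bounded : ∀ {c b bs x} → Descending c (b ∷ bs) → b ≤ x → All (_< suc x) (b ∷ bs)
  descending-bounded desc b≤x = Linked⇒All (λ y>z x>y → <-trans x>y y>z) (s≤s b≤x) (Linked.tail desc)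

  noCrossingBefore-suc : ∀ {c stack} → All (_< suc (low c)) stack → Alive c stack →
                         NoCrossingBefore c → NoCrossingBefore (suc c)
  noCrossingBefore-suc {c} bounded alive none b c′<1+c crossing@(b<c′ , low<b , c′<high)
    with m<1+n⇒m<n∨m≡n c′<1+c
  ... | inj₁ c′<c = none b c′<c crossing
  ... | inj₂ refl with alive b<c′
  ...   | inj₁ b∈stack = <⇒≱ low<b (s≤s⁻¹ (lookupAll bounded b∈stack))
  ...   | inj₂ high≤c  = <⇒≱ c′<high high≤c

adjacencyLists : OrderedGraph → List (List ℕ)
adjacencyLists G = map (map toℕ) (toList (adj G))

nth-map-toList : ∀ {k m} (v : Vec (List (Fin k)) m) (i : Fin m) →
                 nth (map (map toℕ) (toList v)) (toℕ i) ≡ map toℕ (lookup v i)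
nth-map-toList (_ ∷ _) fzero    = refl
nth-map-toList (_ ∷ v) (fsuc i) = nth-map-toList v i

length-adjacencyLists : ∀ G → length (adjacencyLists G) ≡ n G
length-adjacencyLists G = trans (length-map (map toℕ) (toList (adj G))) (length-toList (adj G))

module _ (G : OrderedGraph) where
  open Crossings (adjacencyLists G)

  private
    neighbour-∈ : ∀ {i j} → Edge G i j → toℕ j ∈ nth (adjacencyLists G) (toℕ i)
    neighbour-∈ {i} ij = subst (_ ∈_) (sym (nth-map-toList (adj G) i)) (∈-map⁺ toℕ ij)

    ∈-neighbour : ∀ {x} (i : Fin (n G)) → x ∈ nth (adjacencyLists G) (toℕ i) → ∃ λ j → Edge G i j × x ≡ toℕ j
    ∈-neighbour i x∈ = ∈-map⁻ toℕ (subst (_ ∈_) (nth-map-toList (adj G) i) x∈)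

    crossingᶠ⇒containsP∅ : (bᶠ cᶠ : Fin (n G)) → Crossing (toℕ bᶠ) (toℕ cᶠ) → ContainsP∅ G
    crossingᶠ⇒containsP∅ bᶠ cᶠ (b<c , low<b , c<high)
      with ∈-neighbour cᶠ (low-∈ (<-trans low<b b<c)) | ∈-neighbour bᶠ (high-∈ (<-trans b<c c<high))
    ... | a , ca , low≡a | d , bd , high≡d =
      a , bᶠ , cᶠ , d , subst (_< toℕ bᶠ) low≡a low<b , b<c , subst (toℕ cᶠ <_) high≡d c<high ,
      symm G cᶠ a ca , bd

  containsP∅⇒crossing : ContainsP∅ G → ∃₂ λ b c → c < n G × Crossing b c
  containsP∅⇒crossing (x₁ , x₂ , x₃ , x₄ , x₁<x₂ , x₂<x₃ , x₃<x₄ , x₁x₃ , x₂x₄) =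
    toℕ x₂ , toℕ x₃ , toℕ<n x₃ , x₂<x₃ ,
    ≤-<-trans (foldl-⊓-≤-∈ (toℕ x₃) _ (neighbour-∈ (symm G x₁ x₃ x₁x₃))) x₁<x₂ ,
    <-≤-trans x₃<x₄ (foldl-⊔-≥-∈ (toℕ x₂) _ (neighbour-∈ x₂x₄))

  crossing⇒containsP∅ : ∀ {b c} → c < n G → Crossing b c → ContainsP∅ G
  crossing⇒containsP∅ {b} {c} c<n crossing =
    crossingᶠ⇒containsP∅ (fromℕ< b<n) (fromℕ< c<n)
      (subst₂ Crossing (sym (toℕ-fromℕ< b<n)) (sym (toℕ-fromℕ< c<n)) crossing)
    where
    b<n : b < n G
    b<n = <-trans (proj₁ crossing) c<n

  containsP∅⇒4≤n : ContainsP∅ G → 4 ≤ n G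
  containsP∅⇒4≤n (_ , _ , _ , x₄ , x₁<x₂ , x₂<x₃ , x₃<x₄ , _) =
    ≤-trans (s≤s (≤-trans (s≤s (≤-trans (s≤s (≤-trans (s≤s z≤n) x₁<x₂)) x₂<x₃)) x₃<x₄)) (toℕ<n x₄)

-- Simulation by a machine with registers

write-≡ : ∀ M a v → write M a v a ≡ v
write-≡ M a v with a ≟ a
... | yes _   = refl
... | no a≢a = contradiction refl a≢a

write-≢ : ∀ M {a} v {x} → x ≢ a → write M a v x ≡ M x
write-≢ M {a} v {x} x≢a with x ≟ a
... | yes x≡a = contradiction x≡a x≢a
... | no _    = refl

write-cong : ∀ {M M′ : Memory} a v → (∀ x → M x ≡ M′ x) → ∀ x → write M a v x ≡ write M′ a v x
write-cong a v M≗M′ x with x ≟ a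
... | yes _ = refl
... | no _  = M≗M′ x

regAt : ∀ {m} → Vec ℕ m → ℕ → ℕ
regAt []       _       = 0
regAt (x ∷ xs) zero    = x
regAt (x ∷ xs) (suc i) = regAt xs i

setReg : ∀ {m} → Vec ℕ m → ℕ → ℕ → Vec ℕ m
setReg []       _       _ = []
setReg (x ∷ xs) zero    v = v ∷ xs
setReg (x ∷ xs) (suc i) v = x ∷ setReg xs i v

regAt-setReg-≡ : ∀ {m} (r : Vec ℕ m) {a} v → a < m → regAt (setReg r a v) a ≡ v
regAt-setReg-≡ (x ∷ r) {zero}  v _         = refl
regAt-setReg-≡ (x ∷ r) {suc a} v (s≤s a<m) = regAt-setReg-≡ r v a<m

regAt-setReg-≢ : ∀ {m} (r : Vec ℕ m) {a} v {x} → x ≢ a → regAt (setReg r a v) x ≡ regAt r x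
regAt-setReg-≢ []      {a}     v {x}     _   = refl
regAt-setReg-≢ (y ∷ r) {zero}  v {zero}  x≢a = contradiction refl x≢a
regAt-setReg-≢ (y ∷ r) {zero}  v {suc x} _   = refl
regAt-setReg-≢ (y ∷ r) {suc a} v {zero}  _   = refl
regAt-setReg-≢ (y ∷ r) {suc a} v {suc x} x≢a = regAt-setReg-≢ r v (x≢a ∘ cong suc)

-- Cells below k are kept in a vector of registers, so that code using only literal addresses below k runs
-- by normalisation.  The split state simulates the machine as long as every store goes above k and every
-- load from an address below k finds the same value in the register and in the heap (SafeThen).
module SplitMachine (k : ℕ) where

  record State : Set where
    constructor ⟨_,_,_⟩
    field
      label : ℕ
      regs  : Vec ℕ k
      heap  : Memory

  open State public

  read : State → ℕ → ℕ
  read s x = if x <ᵇ k then regAt (regs s) x else heap s x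

  assign : State → ℕ → ℕ → State
  assign ⟨ l , r , h ⟩ a v =
    if a <ᵇ k then ⟨ suc l , setReg r a v , h ⟩ else ⟨ suc l , r , write h a v ⟩

  storeHeap : State → ℕ → ℕ → State
  storeHeap ⟨ l , r , h ⟩ a v = ⟨ suc l , r , write h a v ⟩

  jumpIfZero : State → ℕ → ℕ → State
  jumpIfZero ⟨ l , r , h ⟩ t zero    = ⟨ t , r , h ⟩
  jumpIfZero ⟨ l , r , h ⟩ t (suc _) = ⟨ suc l , r , h ⟩

  exec : Instr → State → State
  exec (const a v) s = assign s a v
  exec (add a b c) s = assign s a (read s b + read s c)
  exec (sub a b c) s = assign s a (read s b ∸ read s c)
  exec (load a b)  s = assign s a (heap s (read s b))
  exec (store a b) s = storeHeap s (read s a) (read s b)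
  exec (jz a t)    s = jumpIfZero s t (read s a)
  exec halt        s = s

  step′ : Program → State → State
  step′ P s = exec (fetch P (label s)) s

  run′ : Program → ℕ → State → State
  run′ P zero    s = s
  run′ P (suc t) s = run′ P t (step′ P s)

  run′-+ : ∀ P t u s → run′ P (t + u) s ≡ run′ P u (run′ P t s)
  run′-+ P zero    u s = refl
  run′-+ P (suc t) u s = run′-+ P t u (step′ P s)

  Coherent : State → ℕ → Set
  Coherent s x = k ≤ x ⊎ read s x ≡ heap s x

  SafeThen : Instr → State → Set → Set
  SafeThen (load a b)  s X = Coherent s (read s b) × X
  SafeThen (store a b) s X = k ≤ read s a × X
  SafeThen (const a v) s X = X
  SafeThen (add a b c) s X = X
  SafeThen (sub a b c) s X = X
  SafeThen (jz a t)    s X = X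
  SafeThen halt        s X = X

  SafeThen-map : ∀ i s {X Y : Set} → (X → Y) → SafeThen i s X → SafeThen i s Y
  SafeThen-map (load a b)  s f (ok , x) = ok , f x
  SafeThen-map (store a b) s f (ok , x) = ok , f x
  SafeThen-map (const a v) s f x = f x
  SafeThen-map (add a b c) s f x = f x
  SafeThen-map (sub a b c) s f x = f x
  SafeThen-map (jz a t)    s f x = f x
  SafeThen-map halt        s f x = f x

  SafeThen-then : ∀ i s {X} → SafeThen i s X → X
  SafeThen-then (load a b)  s (_ , x) = x
  SafeThen-then (store a b) s (_ , x) = x
  SafeThen-then (const a v) s x = x
  SafeThen-then (add a b c) s x = x
  SafeThen-then (sub a b c) s x = x
  SafeThen-then (jz a t)    s x = x
  SafeThen-then halt        s x = x

  Safe : Program → ℕ → State → Set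
  Safe P zero    s = ⊤
  Safe P (suc t) s = SafeThen (fetch P (label s)) s (Safe P t (step′ P s))

  Safe-+ : ∀ P t u s → Safe P t s → Safe P u (run′ P t s) → Safe P (t + u) s
  Safe-+ P zero    u s _    safe = safe
  Safe-+ P (suc t) u s safe safe′ =
    SafeThen-map (fetch P (label s)) s (λ safe-t → Safe-+ P t u (step′ P s) safe-t safe′) safe

  <ᵇ≡false⇒≥ : ∀ {x} → (x <ᵇ k) ≡ false → k ≤ x
  <ᵇ≡false⇒≥ {x} x≮ᵇk = ≮⇒≥ (λ x<k → subst T x≮ᵇk (<⇒<ᵇ x<k))

  <ᵇ≡false : ∀ {x} → k ≤ x → (x <ᵇ k) ≡ false
  <ᵇ≡false {x} k≤x with x <ᵇ k in x<ᵇk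
  ... | true  = contradiction (<ᵇ⇒< x k (subst T (sym x<ᵇk) tt)) (≤⇒≯ k≤x)
  ... | false = refl

  read-heap : ∀ s {x} → k ≤ x → read s x ≡ heap s x
  read-heap s k≤x rewrite <ᵇ≡false k≤x = refl

  read-assign : ∀ s a v x → read (assign s a v) x ≡ write (read s) a v x
  read-assign ⟨ l , r , h ⟩ a v x with a <ᵇ k in a<ᵇk | x ≟ a
  ... | true  | yes refl rewrite a<ᵇk = regAt-setReg-≡ r v (<ᵇ⇒< a k (subst T (sym a<ᵇk) tt))
  ... | true  | no x≢a = cong₂ (if_then_else_ (x <ᵇ k)) (regAt-setReg-≢ r v x≢a) refl
  ... | false | yes refl rewrite a<ᵇk = write-≡ h a v
  ... | false | no x≢a = cong₂ (if_then_else_ (x <ᵇ k)) refl (write-≢ h v x≢a)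

  read-storeHeap : ∀ s {a} v x → k ≤ a → read (storeHeap s a v) x ≡ write (read s) a v x
  read-storeHeap ⟨ l , r , h ⟩ {a} v x k≤a with x ≟ a
  ... | yes refl rewrite <ᵇ≡false k≤a = refl
  ... | no x≢a  = refl

  label-assign : ∀ s a v → label (assign s a v) ≡ suc (label s)
  label-assign s a v with a <ᵇ k
  ... | true  = refl
  ... | false = refl

  Represents : State → Config → Set
  Represents s c = pc c ≡ label s × (∀ x → mem c x ≡ read s x)

  assign-represents : ∀ s {M} a v → (∀ x → M x ≡ read s x) →
                      Represents (assign s a v) (cfg (suc (label s)) (write M a v))
  assign-represents s a v M≗s =
    sym (label-assign s a v) , λ x → trans (write-cong a v M≗s x) (sym (read-assign s a v x))

  step′-represents : ∀ P s c {X} → Represents s c → SafeThen (fetch P (label s)) s X →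
                     Represents (step′ P s) (step P c)
  step′-represents P s (cfg p M) (refl , M≗s) safe with fetch P (label s)
  ... | const a v = assign-represents s a v M≗s
  ... | add a b c rewrite M≗s b | M≗s c = assign-represents s a _ M≗s
  ... | sub a b c rewrite M≗s b | M≗s c = assign-represents s a _ M≗s
  ... | load a b rewrite M≗s b | M≗s (read s b) with proj₁ safe
  ...   | inj₁ k≤addr rewrite read-heap s k≤addr = assign-represents s a _ M≗s
  ...   | inj₂ coherent rewrite coherent = assign-represents s a _ M≗s
  step′-represents P s (cfg p M) (refl , M≗s) safe | store a b rewrite M≗s a | M≗s b =
    refl , λ x → trans (write-cong _ _ M≗s x) (sym (read-storeHeap s _ x (proj₁ safe)))
  step′-represents P s (cfg p M) (refl , M≗s) safe | jz a t rewrite M≗s a with read s a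
  ...   | zero  = refl , M≗s
  ...   | suc _ = refl , M≗s
  step′-represents P s (cfg p M) (refl , M≗s) safe | halt = refl , M≗s

  run′-represents : ∀ P t s c → Safe P t s → Represents s c → Represents (run′ P t s) (run P t c)
  run′-represents P zero    s c _    s≈c = s≈c
  run′-represents P (suc t) s c safe s≈c =
    run′-represents P t (step′ P s) (step P c) (SafeThen-then (fetch P (label s)) s safe)
      (step′-represents P s c s≈c safe)

  window : (m : ℕ) → Memory → ℕ → Vec ℕ m
  window zero    M a = []
  window (suc m) M a = M a ∷ window m M (suc a)

  regAt-window : ∀ m M a {i} → i < m → regAt (window m M a) i ≡ M (a + i)
  regAt-window (suc m) M a {zero}  _         = cong M (sym (+-identityʳ a))
  regAt-window (suc m) M a {suc i} (s≤s i<m) = trans (regAt-window m M (suc a) i<m) (cong M (sym (+-suc a i)))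

  read-window : ∀ l M x → read ⟨ l , window k M 0 , M ⟩ x ≡ M x
  read-window l M x with x <ᵇ k in x<ᵇk
  ... | true  = regAt-window k M 0 (<ᵇ⇒< x k (subst T (sym x<ᵇk) tt))
  ... | false = refl

  coherent : ∀ {l r h x} → (x < k → regAt r x ≡ h x) → Coherent ⟨ l , r , h ⟩ x
  coherent {x = x} agree with x <ᵇ k in x<ᵇk
  ... | true  = inj₂ (agree (<ᵇ⇒< x k (subst T (sym x<ᵇk) tt)))
  ... | false = inj₁ (<ᵇ≡false⇒≥ x<ᵇk)

  module Reachability (P : Program) (Goal : State → Set) where

    Reaches : State → ℕ → Set
    Reaches s b = ∃ λ t → t ≤ b × Safe P t s × Goal (run′ P t s)

    stop : ∀ {s} → Goal s → Reaches s 0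
    stop goal = 0 , z≤n , tt , goal

    weaken : ∀ {s b b′} → b ≤ b′ → Reaches s b → Reaches s b′
    weaken b≤b′ (t , t≤b , safe , goal) = t , ≤-trans t≤b b≤b′ , safe , goal

    -- Safe P t s normalises to a tuple with one obligation per load and store among the t steps.
    straight : ∀ t s {b} → Safe P t s → Reaches (run′ P t s) b → Reaches s (t + b)
    straight t s safe (u , u≤b , safe′ , goal) =
      t + u , +-monoʳ-≤ t u≤b , Safe-+ P t u s safe safe′ , subst Goal (sym (run′-+ P t u s)) goal

    branch-< : ∀ {l r h a t x y b} → fetch P l ≡ jz a t → read ⟨ l , r , h ⟩ a ≡ suc x ∸ y →
               (x < y → Reaches ⟨ t , r , h ⟩ b) → (y ≤ x → Reaches ⟨ suc l , r , h ⟩ b) →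
               Reaches ⟨ l , r , h ⟩ (suc b)
    branch-< {l} {r} {h} {a} {t} {x} {y} {b} fetched tested jump fallThrough =
      straight 1 s (subst (λ i → SafeThen i s ⊤) (sym fetched) tt)
        (subst (λ i → Reaches (exec i s) b) (sym fetched)
          (subst (λ v → Reaches (jumpIfZero s t v) b) (sym tested) (decide (suc x ∸ y) refl)))
      where
      s : State
      s = ⟨ l , r , h ⟩
      decide : ∀ v → suc x ∸ y ≡ v → Reaches (jumpIfZero s t v) b
      decide zero    ∸≡0   = jump (m∸n≡0⇒m≤n ∸≡0)
      decide (suc _) ∸≡suc = fallThrough (≮⇒≥ (λ x<y → 1+n≢0 (trans (sym ∸≡suc) (m≤n⇒m∸n≡0 x<y))))

-- The program and its main phase

open SplitMachine 16

-- Cells 0–15 serve as registers, so the input is first moved out of their way.  Blocks, by label: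
--    0  if n < 4, answer 0 (for n ≥ 4, B below is at least 16 and beyond the input)
--    5  B := oₙ + 4n; save n and cells 2–5 at B and B+2 … B+5
--   28  copy cells 6 … B−1 to B+6 … 2B−1, so that cell B+i now holds input cell i for 2 ≤ i < B
--   35  sentinel 0 at 2B, c := 0
--   45  for c < n (then answer 0):
--   53    lo, hi := low c, high c
--   62    while the top b of the stack has lo < b: if c < high b, answer 1, else pop
--   66    push the frame (c, hi) at the next two cells above the stack pointer
-- Comparisons x < y are jumps on zero of (1 + x) ∸ y; the sentinel 0 fails the comparison lo < b.
detector : Program
detector =
  const 1 4 ∷ sub 1 1 0 ∷ jz 1 5 ∷ const 0 0 ∷ halt ∷
  const 1 1 ∷ add 1 1 0 ∷ load 1 1 ∷ add 1 1 0 ∷ add 1 1 0 ∷ add 1 1 0 ∷ add 1 1 0 ∷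
  store 1 0 ∷ const 0 1 ∷ add 1 0 1 ∷ add 1 0 1 ∷ store 1 2 ∷ add 1 0 1 ∷ store 1 3 ∷
  add 1 0 1 ∷ store 1 4 ∷ add 1 0 1 ∷ store 1 5 ∷ add 1 0 1 ∷
  const 2 6 ∷ const 3 12 ∷ sub 3 1 3 ∷ const 5 0 ∷
  jz 3 35 ∷ sub 3 3 0 ∷ load 4 2 ∷ store 1 4 ∷ add 2 0 2 ∷ add 1 0 1 ∷ jz 5 28 ∷
  add 14 5 1 ∷ store 14 5 ∷ load 3 2 ∷ add 6 0 2 ∷ add 6 0 6 ∷ add 5 6 3 ∷
  const 7 0 ∷ const 1 0 ∷ const 2 2 ∷ const 4 0 ∷
  jz 3 81 ∷ sub 3 3 0 ∷ load 8 6 ∷ sub 9 8 7 ∷ add 7 1 8 ∷ add 6 0 6 ∷ add 10 1 4 ∷ add 11 1 4 ∷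
  jz 9 62 ∷ sub 9 9 0 ∷ load 12 5 ∷ sub 13 10 12 ∷ sub 10 10 13 ∷ sub 13 12 11 ∷ add 11 11 13 ∷
  add 5 0 5 ∷ jz 1 53 ∷
  load 12 14 ∷ add 13 0 10 ∷ sub 13 13 12 ∷ jz 13 72 ∷
  add 14 2 14 ∷ store 14 4 ∷ add 15 0 14 ∷ store 15 11 ∷ add 4 0 4 ∷ jz 1 45 ∷
  add 15 0 14 ∷ load 12 15 ∷ add 13 0 4 ∷ sub 13 13 12 ∷ jz 13 79 ∷ sub 14 14 2 ∷ jz 1 62 ∷
  const 0 1 ∷ halt ∷
  const 0 0 ∷ halt ∷ []

-- rv counts the vertices left, p and op point into the lists and the offsets, o is the previous offset,
-- cnt counts the list being scanned, sp is the stack pointer and q, x, t, u are scratch.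
mainRegs : (rv c p op o q cnt lo hi x t sp u : ℕ) → Vec ℕ 16
mainRegs rv c p op o q cnt lo hi x t sp u =
  1 ∷ 0 ∷ 2 ∷ rv ∷ c ∷ p ∷ op ∷ o ∷ q ∷ cnt ∷ lo ∷ hi ∷ x ∷ t ∷ sp ∷ u ∷ []

Decided : Set → State → Set
Decided Q s = fetch detector (label s) ≡ halt × (read s 0 ≡ 1 × Q ⊎ read s 0 ≡ 0 × ¬ Q)

Stores : Memory → ℕ → List ℕ → Set
Stores h p []       = ⊤
Stores h p (x ∷ xs) = h p ≡ x × Stores h (suc p) xs

Stores-++ : ∀ h p xs ys → Stores h p (xs ++ ys) → Stores h p xs × Stores h (p + length xs) ys
Stores-++ h p []       ys stored = tt , subst (λ q → Stores h q ys) (sym (+-identityʳ p)) stored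
Stores-++ h p (x ∷ xs) ys (hp≡x , stored) =
  (hp≡x , proj₁ rest) , subst (λ q → Stores h q ys) (sym (+-suc p (length xs))) (proj₂ rest)
  where rest = Stores-++ h (suc p) xs ys stored

AgreeBelow : ℕ → Memory → Memory → Set
AgreeBelow a h h′ = ∀ {x} → x < a → h x ≡ h′ x

AgreeBelow-write : ∀ {a h h′ y} v → a ≤ y → AgreeBelow a h h′ → AgreeBelow a (write h y v) h′
AgreeBelow-write v a≤y agree x<a = trans (write-≢ _ v (<⇒≢ (<-≤-trans x<a a≤y))) (agree x<a)

Stores-transfer : ∀ {a h h′} p xs → p + length xs ≤ a → AgreeBelow a h h′ → Stores h′ p xs → Stores h p xs
Stores-transfer p []       _     _     _                = tt
Stores-transfer {a} p (x ∷ xs) bound agree (h′p≡x , stored) =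
  trans (agree (<-≤-trans (m<m+n p 0<1+n) bound)) h′p≡x ,
  Stores-transfer (suc p) xs (subst (_≤ a) (+-suc p (length xs)) bound) agree stored

m∸[m∸n]≡m⊓n : ∀ m n → m ∸ (m ∸ n) ≡ m ⊓ n
m∸[m∸n]≡m⊓n m n with ≤-total m n
... | inj₁ m≤n = trans (cong (m ∸_) (m≤n⇒m∸n≡0 m≤n)) (sym (m≤n⇒m⊓n≡m m≤n))
... | inj₂ n≤m = trans (m∸[m∸n]≡n n≤m) (sym (m≥n⇒m⊓n≡n n≤m))

m+[n∸m]≡m⊔n : ∀ m n → m + (n ∸ m) ≡ m ⊔ n
m+[n∸m]≡m⊔n m n with ≤-total m n
... | inj₁ m≤n = trans (m+[n∸m]≡n m≤n) (sym (m≤n⇒m⊔n≡n m≤n))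
... | inj₂ n≤m = trans (cong (m +_) (m≤n⇒m∸n≡0 n≤m)) (trans (+-identityʳ m) (sym (m≥n⇒m⊔n≡m n≤m)))

offsets : ℕ → List (List ℕ) → List ℕ
offsets o []       = []
offsets o (l ∷ ls) = (o + length l) ∷ offsets (o + length l) ls

length-offsets : ∀ o ls → length (offsets o ls) ≡ length ls
length-offsets o []       = refl
length-offsets o (l ∷ ls) = cong suc (length-offsets (o + length l) ls)

drop-∷ : ∀ {A : Set} (ls : List (List A)) c {l rs} → drop c ls ≡ l ∷ rs → nth ls c ≡ l × drop (suc c) ls ≡ rs
drop-∷ (_ ∷ ls) zero    refl = refl , refl
drop-∷ (_ ∷ ls) (suc c) eq   = drop-∷ ls c eq

scanCost : List ℕ → ℕ → ℕ
scanCost []       b = 1 + b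
scanCost (_ ∷ xs) b = 9 + scanCost xs b

popCost : List ℕ → ℕ → ℕ
popCost []       b = b
popCost (_ ∷ bs) b = 11 + popCost bs b

sweepCost : List (List ℕ) → ℕ
sweepCost []       = 2
sweepCost (l ∷ ls) = 30 + 9 * length l + sweepCost ls

-- Each stack entry carries 11 steps of credit, which pay for popping it.
mainCost : List (List ℕ) → List ℕ → ℕ
mainCost ls stack = 11 * length stack + sweepCost ls

scanCost-closed : ∀ xs b → scanCost xs b ≡ 9 * length xs + 1 + b
scanCost-closed []       b = refl
scanCost-closed (_ ∷ xs) b = trans (cong (9 +_) (scanCost-closed xs b))
  (solve 2 (λ k b → con 9 :+ (con 9 :* k :+ con 1 :+ b) := con 9 :* (con 1 :+ k) :+ con 1 :+ b) refl (length xs) b)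

popCost-closed : ∀ bs b → popCost bs b ≡ 11 * length bs + b
popCost-closed []       b = refl
popCost-closed (_ ∷ bs) b = trans (cong (11 +_) (popCost-closed bs b))
  (solve 2 (λ k b → con 11 :+ (con 11 :* k :+ b) := con 11 :* (con 1 :+ k) :+ b) refl (length bs) b)

mainCost-iteration : ∀ l ls stack → 8 + scanCost l (4 + popCost stack (17 + sweepCost ls)) ≡ mainCost (l ∷ ls) stack
mainCost-iteration l ls stack = begin
  8 + scanCost l (4 + popCost stack (17 + sweepCost ls))
    ≡⟨ cong (8 +_) (trans (scanCost-closed l _) (cong (λ v → 9 * length l + 1 + (4 + v)) (popCost-closed stack _))) ⟩
  8 + (9 * length l + 1 + (4 + (11 * length stack + (17 + sweepCost ls))))
    ≡⟨ solve 3 (λ a s x → con 8 :+ (con 9 :* a :+ con 1 :+ (con 4 :+ (con 11 :* s :+ (con 17 :+ x))))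
                         := con 11 :* s :+ (con 30 :+ con 9 :* a :+ x)) refl (length l) (length stack) (sweepCost ls) ⟩
  mainCost (l ∷ ls) stack ∎
  where open ≡-Reasoning

mainCost-push : ∀ ls c stack → 6 + mainCost ls (c ∷ stack) ≡ popCost stack (17 + sweepCost ls)
mainCost-push ls c stack = begin
  6 + (11 * suc (length stack) + sweepCost ls)
    ≡⟨ solve 2 (λ s x → con 6 :+ (con 11 :* (con 1 :+ s) :+ x) := con 11 :* s :+ (con 17 :+ x)) refl (length stack) (sweepCost ls) ⟩
  11 * length stack + (17 + sweepCost ls)
    ≡⟨ sym (popCost-closed stack _) ⟩
  popCost stack (17 + sweepCost ls) ∎
  where open ≡-Reasoning

module MainPhase (Ls : List (List ℕ)) (input : Memory) (base : ℕ) (16≤base : 16 ≤ base) where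
  open Crossings Ls
  open Reachability detector (Decided HasCrossing)

  scanLoop : ∀ {b} xs {rv c p op o q lo hi x t sp u h} → 16 ≤ p → Stores h p xs →
    (∀ {p′ lo′ hi′} x′ t′ → p′ ≡ p + length xs → lo′ ≡ foldl _⊓_ lo xs → hi′ ≡ foldl _⊔_ hi xs →
       Reaches ⟨ 62 , mainRegs rv c p′ op o q 0 lo′ hi′ x′ t′ sp u , h ⟩ b) →
    Reaches ⟨ 53 , mainRegs rv c p op o q (length xs) lo hi x t sp u , h ⟩ (scanCost xs b)
  scanLoop []       {p = p} _ _ continue = straight 1 _ tt (continue _ _ (sym (+-identityʳ p)) refl refl)
  scanLoop (y ∷ ys) {p = p} {lo = lo} {hi = hi} {h = h} 16≤p (hp≡y , stored) continue =
    straight 9 _ (inj₁ 16≤p , tt) (scanLoop ys (m≤n⇒m≤1+n 16≤p) stored λ x′ t′ p′≡ lo′≡ hi′≡ →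
      continue x′ t′ (trans p′≡ (sym (+-suc p (length ys))))
        (trans lo′≡ (cong (λ v → foldl _⊓_ v ys) (trans (m∸[m∸n]≡m⊓n lo (h p)) (cong (lo ⊓_) hp≡y))))
        (trans hi′≡ (cong (λ v → foldl _⊔_ v ys) (trans (m+[n∸m]≡m⊔n hi (h p)) (cong (hi ⊔_) hp≡y)))))

  data StackAt (h : Memory) : ℕ → List ℕ → Set where
    empty : h base ≡ 0 → StackAt h base []
    push  : ∀ {sp b bs} → StackAt h sp bs → h (2 + sp) ≡ b → h (3 + sp) ≡ high b → StackAt h (2 + sp) (b ∷ bs)

  StackAt-base : ∀ {h sp stack} → StackAt h sp stack → base ≤ sp
  StackAt-base (empty _)    = ≤-refl
  StackAt-base (push s _ _) = m≤n⇒m≤1+n (m≤n⇒m≤1+n (StackAt-base s))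

  StackAt-write : ∀ {h sp stack a} v → suc sp < a → StackAt h sp stack → StackAt (write h a v) sp stack
  StackAt-write v sp<a (empty h≡0) = empty (trans (write-≢ _ v (<⇒≢ (<-trans (n<1+n _) sp<a))) h≡0)
  StackAt-write v sp<a (push s h≡b h≡high) =
    push (StackAt-write v (<-trans (n<1+n _) (<-trans (n<1+n _) sp<a)) s)
      (trans (write-≢ _ v (<⇒≢ (<-trans (n<1+n _) sp<a))) h≡b) (trans (write-≢ _ v (<⇒≢ sp<a)) h≡high)

  StackAt-push : ∀ {h sp stack} c {v} → v ≡ high c → StackAt h sp stack →
                 StackAt (write (write h (2 + sp) c) (3 + sp) v) (2 + sp) (c ∷ stack)
  StackAt-push {h} {sp} c {v} v≡high s =
    push (StackAt-write v (<-trans (n<1+n _) (n<1+n _)) (StackAt-write c (n<1+n _) s))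
      (trans (write-≢ (write h (2 + sp) c) {3 + sp} v (<⇒≢ (n<1+n _))) (write-≡ h (2 + sp) c)) (trans (write-≡ _ (3 + sp) v) v≡high)

  popLoop : ∀ {b} stack {rv c p op o q lo hi x t sp u h} → lo ≡ low c → c < length Ls →
    StackAt h sp stack → Descending c stack → Alive c stack → NoCrossingBefore c →
    (∀ {stack′ sp′} x′ t′ u′ → StackAt h sp′ stack′ → Descending c stack′ → Alive c stack′ →
       NoCrossingBefore (suc c) → Reaches ⟨ 66 , mainRegs rv c p op o q 0 lo hi x′ t′ sp′ u′ , h ⟩ (popCost stack′ b)) →
    Reaches ⟨ 62 , mainRegs rv c p op o q 0 lo hi x t sp u , h ⟩ (4 + popCost stack b)
  popLoop [] {lo = lo} {u = u} {h = h} _ _ (empty h≡0) desc alive none continue =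
    straight 3 _ (inj₁ 16≤base , tt) (branch-< refl refl
      (λ lo<0 → contradiction (subst (lo <_) h≡0 lo<0) λ ())
      (λ _ → continue (h base) (suc lo ∸ h base) u (empty h≡0) desc alive (noCrossingBefore-suc [] alive none)))
  popLoop (b₀ ∷ bs) {c = c} {lo = lo} {u = u} {h = h} lo≡low c<n stack@(push {sp} s h≡b₀ h≡high) desc alive none continue =
    straight 3 _ (inj₁ 16≤sp , tt) (branch-< refl refl
      (λ lo<top → straight 4 _ (inj₁ (m≤n⇒m≤1+n 16≤sp) , tt) (branch-< refl refl
        (λ c<high → weaken (s≤s z≤n) (straight 1 _ tt (stop (refl , inj₁ (refl , b₀ , c , c<n ,
           Linked.head desc , subst₂ _<_ lo≡low h≡b₀ lo<top , subst (c <_) h≡high c<high)))))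
        (λ high≤c → straight 2 _ tt (popLoop bs lo≡low c<n s (descending-pop desc)
           (alive-pop alive (subst (_≤ c) h≡high high≤c)) none continue))))
      (λ top≤lo → continue (h (2 + sp)) (suc lo ∸ h (2 + sp)) u stack desc alive
        (noCrossingBefore-suc (descending-bounded desc (subst₂ _≤_ h≡b₀ lo≡low top≤lo)) alive none)))
    where
    16≤sp : 16 ≤ 2 + sp
    16≤sp = ≤-trans 16≤base (StackAt-base stack)

  mainLoop : ∀ rs {c stack p op o q cnt lo hi x t sp u h} →
    c + length rs ≡ length Ls → drop c Ls ≡ rs → 16 ≤ p → 16 ≤ op →
    Stores input p (concat rs) → Stores input op (offsets o rs) →
    p + length (concat rs) ≤ base → op + length rs ≤ base → AgreeBelow base h input →
    StackAt h sp stack → Descending c stack → Alive c stack → NoCrossingBefore c →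
    Reaches ⟨ 45 , mainRegs (length rs) c p op o q cnt lo hi x t sp u , h ⟩ (mainCost rs stack)
  mainLoop [] {c} {stack} c+0≡n _ _ _ _ _ _ _ _ _ _ _ none =
    weaken (m≤n+m 2 (11 * length stack)) (straight 2 _ tt (stop (refl , inj₂ (refl ,
      λ (b , c′ , c′<n , crossing) → none b (subst (c′ <_) (trans (sym c+0≡n) (+-identityʳ c)) c′<n) crossing))))
  mainLoop (l ∷ rs) {c} {stack} {p} {op} {o} {q} {cnt} {lo} {hi} {x} {t} {sp} {u} {h}
           c+≡n dropped 16≤p 16≤op lists (input-op≡ , offs) p-bound op-bound agree s desc alive none =
    subst (Reaches _) (mainCost-iteration l rs stack) (straight 8 _ (inj₁ 16≤op , tt)
      (subst (λ cnt → Reaches ⟨ 53 , mainRegs (length rs) c p (suc op) (h op) (h op) cnt c c x t sp u , h ⟩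
                               (scanCost l (4 + popCost stack (17 + sweepCost rs))))
        (sym length-l) (scanLoop l 16≤p (Stores-transfer p l l-bound agree (proj₁ split))
          λ {p′} {lo′} {hi′} x′ t′ p′≡ lo′≡ hi′≡ →
            popLoop stack (trans lo′≡ (cong (foldl _⊓_ c) (sym nth≡l))) c<n s desc alive none
              λ {stack′} {sp′} x″ t″ u″ s′ desc′ alive′ none′ →
                subst (Reaches _) (mainCost-push rs c stack′) (straight 6 _ (16≤2+ s′ , m≤n⇒m≤1+n (16≤2+ s′) , tt)
                  (mainLoop rs (trans (sym (+-suc c (length rs))) c+≡n) (proj₂ (drop-∷ Ls c dropped))
                    (subst (16 ≤_) (sym p′≡) (≤-trans 16≤p (m≤m+n p (length l)))) (m≤n⇒m≤1+n 16≤op)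
                    (subst (λ a → Stores input a (concat rs)) (sym p′≡) (proj₂ split))
                    (subst (λ v → Stores input (suc op) (offsets v rs)) (sym h-op≡) offs)
                    (subst (λ a → a + length (concat rs) ≤ base) (sym p′≡) total-bound)
                    (subst (_≤ base) (+-suc op (length rs)) op-bound)
                    (AgreeBelow-write hi′ (m≤n⇒m≤1+n (base≤2+ s′)) (AgreeBelow-write c (base≤2+ s′) agree))
                    (StackAt-push c (trans hi′≡ (cong (foldl _⊔_ c) (sym nth≡l))) s′)
                    (descending-push desc′) (alive-push alive′) none′)))))
    where
    nth≡l : nth Ls c ≡ l
    nth≡l = proj₁ (drop-∷ Ls c dropped)
    c<n : c < length Ls
    c<n = subst (c <_) c+≡n (m<m+n c 0<1+n)
    split : Stores input p l × Stores input (p + length l) (concat rs)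
    split = Stores-++ input p l (concat rs) lists
    total-bound : p + length l + length (concat rs) ≤ base
    total-bound = subst (_≤ base) (trans (cong (p +_) (length-++ l)) (sym (+-assoc p (length l) _))) p-bound
    l-bound : p + length l ≤ base
    l-bound = ≤-trans (m≤m+n _ _) total-bound
    h-op≡ : h op ≡ o + length l
    h-op≡ = trans (agree (<-≤-trans (m<m+n op 0<1+n) op-bound)) input-op≡
    length-l : h op ∸ o ≡ length l
    length-l = trans (cong (_∸ o) h-op≡) (m+n∸m≡n o (length l))
    base≤2+ : ∀ {sp′ stack′} → StackAt h sp′ stack′ → base ≤ 2 + sp′
    base≤2+ s′ = m≤n⇒m≤1+n (m≤n⇒m≤1+n (StackAt-base s′))
    16≤2+ : ∀ {sp′ stack′} → StackAt h sp′ stack′ → 16 ≤ 2 + sp′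
    16≤2+ s′ = ≤-trans 16≤base (base≤2+ s′)

-- Relocating the input

encoding : List (List ℕ) → List ℕ
encoding ls = length ls ∷ 0 ∷ (offsets 0 ls ++ concat ls)

listAt-offsets : ∀ o ls ys → listAt (o ∷ (offsets o ls ++ ys)) (length ls) ≡ o + length (concat ls)
listAt-offsets o []       ys = sym (+-identityʳ o)
listAt-offsets o (l ∷ ls) ys = trans (listAt-offsets (o + length l) ls ys)
  (trans (+-assoc o (length l) _) (cong (o +_) (sym (length-++ l))))

Stores-listAt : ∀ h p xs → (∀ {i} → i < length xs → h (p + i) ≡ listAt xs i) → Stores h p xs
Stores-listAt h p []       _      = tt
Stores-listAt h p (x ∷ xs) agrees =
  trans (cong h (sym (+-identityʳ p))) (agrees 0<1+n) ,
  Stores-listAt h (suc p) xs (λ i<len → trans (cong h (sym (+-suc p _))) (agrees (s≤s i<len)))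

copyCost : ℕ → ℕ → ℕ
copyCost zero    b = 1 + b
copyCost (suc k) b = 7 + copyCost k b

module Setup (Ls : List (List ℕ)) where
  open Crossings Ls
  open Reachability detector (Decided HasCrossing)

  M₀ : Memory
  M₀ = listAt (encoding Ls)

  copyRegs : (dst k cnt tv : ℕ) → Vec ℕ 16
  copyRegs dst k cnt tv = 1 ∷ dst ∷ k ∷ cnt ∷ tv ∷ 0 ∷ window 10 M₀ 6

  copy-coherent : ∀ {l dst k cnt tv h a} → 6 ≤ k → k < a → AgreeBelow a h M₀ →
                  Coherent ⟨ l , copyRegs dst k cnt tv , h ⟩ k
  copy-coherent {l} {dst} {k} {cnt} {tv} {h} (s≤s (s≤s (s≤s (s≤s (s≤s (s≤s _)))))) k<a agree =
    coherent {l} {copyRegs dst k cnt tv} {h}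
      λ { (s≤s (s≤s (s≤s (s≤s (s≤s (s≤s j<10)))))) → trans (regAt-window 10 M₀ 6 j<10) (sym (agree k<a)) }

  module Relocation (B : ℕ) (16≤B : 16 ≤ B) where

    Copied : Memory → ℕ → Set
    Copied h k = ∀ {x} → 2 ≤ x → x < k → h (B + x) ≡ M₀ x

    Copied-write : ∀ {h k dst v} → dst ≡ B + k → v ≡ M₀ k → Copied h k → Copied (write h dst v) (suc k)
    Copied-write {h} {k} {v = v} refl v≡ copied {x} 2≤x x<1+k with m<1+n⇒m<n∨m≡n x<1+k
    ... | inj₁ x<k  = trans (write-≢ h {B + k} v (<⇒≢ (+-monoʳ-< B x<k))) (copied 2≤x x<k)
    ... | inj₂ refl = trans (write-≡ h (B + x) v) v≡

    savedUpTo : ℕ → Memory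
    savedUpTo zero    = write M₀ B (length Ls)
    savedUpTo (suc i) = write (savedUpTo i) (2 + i + B) (M₀ (2 + i))

    savedUpTo-agree : ∀ i → AgreeBelow B (savedUpTo i) M₀
    savedUpTo-agree zero    = AgreeBelow-write (length Ls) ≤-refl (λ _ → refl)
    savedUpTo-agree (suc i) = AgreeBelow-write (M₀ (2 + i)) (m≤n+m B (2 + i)) (savedUpTo-agree i)

    savedUpTo-copied : ∀ i → Copied (savedUpTo i) (2 + i)
    savedUpTo-copied zero    2≤x x<2 = contradiction x<2 (≤⇒≯ 2≤x)
    savedUpTo-copied (suc i) = Copied-write {savedUpTo i} (+-comm (2 + i) B) refl (savedUpTo-copied i)

    savedUpTo-length : ∀ i → savedUpTo i B ≡ length Ls
    savedUpTo-length zero    = write-≡ M₀ B (length Ls)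
    savedUpTo-length (suc i) =
      trans (write-≢ (savedUpTo i) (M₀ (2 + i)) (<⇒≢ (m<n+m B {2 + i} 0<1+n))) (savedUpTo-length i)

    copyLoop : ∀ {b} cnt {k dst tv h} → k + cnt ≡ B → dst ≡ B + k → 6 ≤ k →
      AgreeBelow B h M₀ → Copied h k → h B ≡ length Ls →
      (∀ {dst′ k′ h′} tv′ → dst′ ≡ B + B → k′ ≡ B → AgreeBelow B h′ M₀ → Copied h′ B → h′ B ≡ length Ls →
         Reaches ⟨ 35 , copyRegs dst′ k′ 0 tv′ , h′ ⟩ b) →
      Reaches ⟨ 28 , copyRegs dst k cnt tv , h ⟩ (copyCost cnt b)
    copyLoop zero {k} {h = h} k+0≡B dst≡ _ agree copied h-B continue =
      straight 1 _ tt (continue _ (trans dst≡ (cong (B +_) k≡B)) k≡B agree (subst (Copied h) k≡B copied) h-B)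
      where
      k≡B : k ≡ B
      k≡B = trans (sym (+-identityʳ k)) k+0≡B
    copyLoop (suc cnt) {k} {dst} {tv} {h} k+≡B dst≡ 6≤k agree copied h-B continue =
      straight 7 _ (copy-coherent {30} {dst} {cnt = cnt} {tv = tv} 6≤k k<B agree , 16≤dst , tt)
        (copyLoop cnt (trans (sym (+-suc k cnt)) k+≡B) (trans (cong suc dst≡) (sym (+-suc B k))) (m≤n⇒m≤1+n 6≤k)
          (AgreeBelow-write (h k) (<⇒≤ B<dst) agree) (Copied-write {h} dst≡ (agree k<B) copied)
          (trans (write-≢ h {dst} (h k) (<⇒≢ B<dst)) h-B) continue)
      where
      k<B : k < B
      k<B = subst (k <_) k+≡B (m<m+n k 0<1+n)
      B<dst : B < dst
      B<dst = subst (B <_) (sym dst≡) (m<m+n B (<-≤-trans 0<1+n 6≤k))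
      16≤dst : 16 ≤ dst
      16≤dst = ≤-trans 16≤B (<⇒≤ B<dst)

    module _ (fits : 2 + length Ls + length (concat Ls) ≤ B) where

      image-bound : 2 + B + length Ls + length (concat Ls) ≤ B + B
      image-bound = subst (_≤ B + B)
        (solve 3 (λ b n a → b :+ (con 2 :+ n :+ a) := con 2 :+ b :+ n :+ a) refl B (length Ls) (length (concat Ls)))
        (+-monoʳ-≤ B fits)

      enterMain : ∀ {dst k h} tv → dst ≡ B + B → k ≡ B → AgreeBelow B h M₀ → Copied h B → h B ≡ length Ls →
                  Reaches ⟨ 35 , copyRegs dst k 0 tv , h ⟩ (10 + mainCost Ls [])
      enterMain {h = h} tv refl refl _ copied h-B =
        straight 10 _ (16≤B+B , inj₁ 16≤B , tt)
          (subst (λ v → Reaches ⟨ 45 , mainRegs v 0 (2 + B + v) (2 + B) 0 (M₀ 8) (M₀ 9) (M₀ 10) (M₀ 11) (M₀ 12) (M₀ 13)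
                                                 (B + B) (M₀ 15) , h′ ⟩ (mainCost Ls []))
            (sym h′-B)
            (mainLoop Ls refl refl (≤-trans 16≤B (≤-trans (m≤n+m B 2) (m≤m+n _ _))) (m≤n⇒m≤1+n (m≤n⇒m≤1+n 16≤B))
              (Stores-transfer _ (concat Ls) image-bound below lists)
              (Stores-transfer _ (offsets 0 Ls) offsets-bound below offs)
              image-bound (≤-trans (m≤m+n _ _) image-bound)
              (λ _ → refl) (empty (write-≡ h (B + B) 0)) [-] (λ ()) (λ _ ())))
        where
        16≤B+B : 16 ≤ B + B
        16≤B+B = ≤-trans 16≤B (m≤m+n B B)
        h′ : Memory
        h′ = write h (B + B) 0
        open MainPhase Ls h′ (B + B) 16≤B+B
        h′-B : h′ B ≡ length Ls
        h′-B = trans (write-≢ h {B + B} 0 (<⇒≢ (m<m+n B (<-≤-trans 0<1+n 16≤B)))) h-B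
        below : AgreeBelow (B + B) h′ h
        below = AgreeBelow-write 0 ≤-refl (λ _ → refl)
        length-image : length (offsets 0 Ls ++ concat Ls) ≡ length Ls + length (concat Ls)
        length-image = trans (length-++ (offsets 0 Ls)) (cong (_+ length (concat Ls)) (length-offsets 0 Ls))
        image : Stores h (2 + B) (offsets 0 Ls ++ concat Ls)
        image = Stores-listAt h (2 + B) _ λ {i} i<len →
          trans (cong h (sym (trans (+-suc B (suc i)) (cong suc (+-suc B i)))))
            (copied (s≤s (s≤s z≤n)) (<-≤-trans (s≤s (s≤s (subst (i <_) length-image i<len))) fits))
        offs : Stores h (2 + B) (offsets 0 Ls)
        offs = proj₁ (Stores-++ h (2 + B) (offsets 0 Ls) (concat Ls) image)
        lists : Stores h (2 + B + length Ls) (concat Ls)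
        lists = subst (λ m → Stores h (2 + B + m) (concat Ls)) (length-offsets 0 Ls)
                  (proj₂ (Stores-++ h (2 + B) (offsets 0 Ls) (concat Ls) image))
        offsets-bound : 2 + B + length (offsets 0 Ls) ≤ B + B
        offsets-bound = subst (λ m → 2 + B + m ≤ B + B) (sym (length-offsets 0 Ls)) (≤-trans (m≤m+n _ _) image-bound)

  start-coherent : ∀ {l m} → 3 < m → Coherent ⟨ l , m ∷ suc m ∷ window 14 M₀ 2 , M₀ ⟩ (suc m)
  start-coherent {l} {m@(suc (suc (suc (suc j))))} (s≤s (s≤s (s≤s (s≤s _)))) =
    coherent {l} {m ∷ suc m ∷ window 14 M₀ 2} {M₀}
      λ { (s≤s (s≤s (s≤s (s≤s (s≤s (s≤s j<10)))))) → regAt-window 14 M₀ 2 (s≤s (s≤s (s≤s (s≤s j<10)))) }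

  relocationBase : ℕ
  relocationBase = M₀ (suc (length Ls)) + length Ls + length Ls + length Ls + length Ls

  relocationBase≡ : relocationBase ≡ length (concat Ls) + length Ls + length Ls + length Ls + length Ls
  relocationBase≡ = cong (λ a → a + length Ls + length Ls + length Ls + length Ls) (listAt-offsets 0 Ls (concat Ls))

  module _ (4≤n : 4 ≤ length Ls) where

    private
      N A : ℕ
      N = length Ls
      A = length (concat Ls)

      relocationBase-split : relocationBase ≡ (A + N) + (N + N + N)
      relocationBase-split =
        trans relocationBase≡ (solve 2 (λ a n → a :+ n :+ n :+ n :+ n := (a :+ n) :+ (n :+ n :+ n)) refl A N)

    16≤relocationBase : 16 ≤ relocationBase
    16≤relocationBase = subst (16 ≤_) (sym relocationBase-split)
      (+-mono-≤ (≤-trans 4≤n (m≤n+m N A)) (+-mono-≤ (+-mono-≤ 4≤n 4≤n) 4≤n))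

    relocationBase-fits : 2 + N + A ≤ relocationBase
    relocationBase-fits = subst₂ _≤_ (solve 2 (λ a n → (a :+ n) :+ con 2 := con 2 :+ n :+ a) refl A N)
      (sym relocationBase-split)
      (+-monoʳ-≤ (A + N) (≤-trans (≤-trans (m≤n+m 2 2) 4≤n) (≤-trans (m≤m+n N N) (m≤m+n (N + N) N))))

  copyPhaseCost : ℕ
  copyPhaseCost = copyCost (relocationBase ∸ 6) (10 + mainCost Ls [])

  -- The block is cut into segments with explicit intermediate states: normalising it in one go is too slow.
  relocate : 3 < length Ls → Reaches ⟨ 5 , length Ls ∷ (4 ∸ length Ls) ∷ window 14 M₀ 2 , M₀ ⟩ (23 + copyPhaseCost)
  relocate 4≤n = straight 7 _ (start-coherent {7} 4≤n , tt) saveLength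
    where
    B : ℕ
    B = relocationBase
    16≤B : 16 ≤ B
    16≤B = 16≤relocationBase 4≤n
    16≤+ : ∀ i → 16 ≤ i + B
    16≤+ i = ≤-trans 16≤B (m≤n+m B i)
    open Relocation B 16≤B
    copying : Reaches ⟨ 23 , 1 ∷ (5 + B) ∷ window 14 M₀ 2 , savedUpTo 4 ⟩ (5 + copyPhaseCost)
    copying = straight 5 _ tt (copyLoop (B ∸ 6) (m+[n∸m]≡n (≤-trans (m≤n+m 6 10) 16≤B)) (+-comm 6 B) ≤-refl
      (savedUpTo-agree 4) (savedUpTo-copied 4) (savedUpTo-length 4) (enterMain (relocationBase-fits 4≤n)))
    save₄₅ : Reaches ⟨ 20 , 1 ∷ (4 + B) ∷ window 14 M₀ 2 , savedUpTo 2 ⟩ (3 + (5 + copyPhaseCost))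
    save₄₅ = straight 3 _ (16≤+ 4 , 16≤+ 5 , tt) copying
    save₂₃ : Reaches ⟨ 16 , 1 ∷ (2 + B) ∷ window 14 M₀ 2 , savedUpTo 0 ⟩ (4 + (3 + (5 + copyPhaseCost)))
    save₂₃ = straight 4 _ (16≤+ 2 , 16≤+ 3 , tt) save₄₅
    saveLength : Reaches ⟨ 12 , length Ls ∷ B ∷ window 14 M₀ 2 , M₀ ⟩ (16 + copyPhaseCost)
    saveLength = straight 4 _ (16≤+ 0 , tt) save₂₃

  startCost : ℕ
  startCost = 2 + (1 + (23 + copyPhaseCost))

  start : (HasCrossing → 4 ≤ length Ls) → Reaches ⟨ 0 , window 16 M₀ 0 , M₀ ⟩ startCost
  start needs4 = straight 2 _ tt (branch-< refl refl relocate small)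
    where
    small : length Ls ≤ 3 → Reaches ⟨ 3 , length Ls ∷ (4 ∸ length Ls) ∷ window 14 M₀ 2 , M₀ ⟩ (23 + copyPhaseCost)
    small n≤3 = weaken (s≤s z≤n) (straight 1 _ tt (stop (refl , inj₂ (refl , λ crossing → <⇒≱ (s≤s n≤3) (needs4 crossing)))))

-- Running time and the theorem

copyCost-closed : ∀ k b → copyCost k b ≡ 7 * k + 1 + b
copyCost-closed zero    b = refl
copyCost-closed (suc k) b = trans (cong (7 +_) (copyCost-closed k b))
  (solve 2 (λ k b → con 7 :+ (con 7 :* k :+ con 1 :+ b) := con 7 :* (con 1 :+ k) :+ con 1 :+ b) refl k b)

sweepCost-closed : ∀ ls → sweepCost ls ≡ 30 * length ls + 9 * length (concat ls) + 2
sweepCost-closed []       = refl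
sweepCost-closed (l ∷ ls) = begin
  30 + 9 * length l + sweepCost ls
    ≡⟨ cong (30 + 9 * length l +_) (sweepCost-closed ls) ⟩
  30 + 9 * length l + (30 * length ls + 9 * length (concat ls) + 2)
    ≡⟨ solve 3 (λ a r c → con 30 :+ con 9 :* a :+ (con 30 :* r :+ con 9 :* c :+ con 2)
                         := con 30 :* (con 1 :+ r) :+ con 9 :* (a :+ c) :+ con 2) refl (length l) (length ls) (length (concat ls)) ⟩
  30 * suc (length ls) + 9 * (length l + length (concat ls)) + 2
    ≡⟨ cong (λ m → 30 * suc (length ls) + 9 * m + 2) (sym (length-++ l)) ⟩
  30 * suc (length ls) + 9 * length (l ++ concat ls) + 2 ∎
  where open ≡-Reasoning

startCost-bound : ∀ ls → Setup.startCost ls ≤ 100 * (length ls + length (concat ls)) + 100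
startCost-bound ls = begin
  Setup.startCost ls
    ≡⟨ cong (26 +_) (copyCost-closed (B ∸ 6) _) ⟩
  26 + (7 * (B ∸ 6) + 1 + (10 + sweepCost ls))
    ≤⟨ +-monoʳ-≤ 26 (+-monoˡ-≤ (10 + sweepCost ls) (+-monoˡ-≤ 1 (*-monoʳ-≤ 7 (m∸n≤m B 6)))) ⟩
  26 + (7 * B + 1 + (10 + sweepCost ls))
    ≡⟨ cong₂ (λ b s → 26 + (7 * b + 1 + (10 + s))) (Setup.relocationBase≡ ls) (sweepCost-closed ls) ⟩
  26 + (7 * (A + N + N + N + N) + 1 + (10 + (30 * N + 9 * A + 2)))
    ≤⟨ m≤m+n _ (42 * N + 84 * A + 61) ⟩
  26 + (7 * (A + N + N + N + N) + 1 + (10 + (30 * N + 9 * A + 2))) + (42 * N + 84 * A + 61)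
    ≡⟨ solve 2 (λ a n → con 26 :+ (con 7 :* (a :+ n :+ n :+ n :+ n) :+ con 1 :+ (con 10 :+ (con 30 :* n :+ con 9 :* a :+ con 2)))
                        :+ (con 42 :* n :+ con 84 :* a :+ con 61) := con 100 :* (n :+ a) :+ con 100) refl A N ⟩
  100 * (N + A) + 100 ∎
  where
  open ≤-Reasoning
  B N A : ℕ
  B = Setup.relocationBase ls
  N = length ls
  A = length (concat ls)

scanl-offsets : ∀ o ls → scanl _+_ o (map length ls) ≡ o ∷ offsets o ls
scanl-offsets o []       = refl
scanl-offsets o (l ∷ ls) = cong (o ∷_) (scanl-offsets (o + length l) ls)

length-concat : ∀ {A : Set} (ls : List (List A)) → length (concat ls) ≡ sum (map length ls)
length-concat []       = refl
length-concat (l ∷ ls) = trans (length-++ l) (cong (length l +_) (length-concat ls))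

module _ (G : OrderedGraph) where
  private
    Ls : List (List ℕ)
    Ls = adjacencyLists G

  open Crossings Ls
  open Setup Ls using (M₀; start; startCost)
  open Reachability detector (Decided HasCrossing)

  map-length-adjacencyLists : map length Ls ≡ map length (toList (adj G))
  map-length-adjacencyLists = trans (sym (map-∘ (toList (adj G)))) (map-cong (length-map toℕ) (toList (adj G)))

  encodeList≡encoding : encodeList G ≡ encoding Ls
  encodeList≡encoding = cong₂ _∷_ (sym (length-adjacencyLists G))
    (cong (_++ concat Ls) (trans (cong (scanl _+_ 0) (sym map-length-adjacencyLists)) (scanl-offsets 0 Ls)))

  adjSize≡length-concat : adjSize G ≡ length (concat Ls)
  adjSize≡length-concat = sym (trans (length-concat Ls) (cong sum map-length-adjacencyLists))

  hasCrossing⇒containsP∅ : HasCrossing → ContainsP∅ G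
  hasCrossing⇒containsP∅ (b , c , c<len , crossing) =
    crossing⇒containsP∅ G (subst (c <_) (length-adjacencyLists G) c<len) crossing

  containsP∅⇒hasCrossing : ContainsP∅ G → HasCrossing
  containsP∅⇒hasCrossing contains with containsP∅⇒crossing G contains
  ... | b , c , c<n , crossing = b , c , subst (c <_) (sym (length-adjacencyLists G)) c<n , crossing

  initial-represents : Represents ⟨ 0 , window 16 M₀ 0 , M₀ ⟩ (initial G)
  initial-represents = refl , λ x → trans (cong (λ l → listAt l x) encodeList≡encoding) (sym (read-window 0 M₀ x))

  Decides : ℕ → Set
  Decides bound = Σ ℕ λ t → (t ≤ bound) × Halted detector (run detector t (initial G)) ×
    ((mem (run detector t (initial G)) 0 ≡ 1 × ContainsP∅ G) ⊎ (mem (run detector t (initial G)) 0 ≡ 0 × ¬ ContainsP∅ G))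

  reaches⇒decides : ∀ {b b′} → b ≤ b′ → Reaches ⟨ 0 , window 16 M₀ 0 , M₀ ⟩ b → Decides b′
  reaches⇒decides b≤b′ (t , t≤b , safe , halted , answer) =
    t , ≤-trans t≤b b≤b′ , trans (cong (fetch detector) (proj₁ final)) halted , translate answer
    where
    final : Represents (run′ detector t ⟨ 0 , window 16 M₀ 0 , M₀ ⟩) (run detector t (initial G))
    final = run′-represents detector t ⟨ 0 , window 16 M₀ 0 , M₀ ⟩ (initial G) safe initial-represents
    s : State
    s = run′ detector t ⟨ 0 , window 16 M₀ 0 , M₀ ⟩
    translate : (read s 0 ≡ 1 × HasCrossing) ⊎ (read s 0 ≡ 0 × ¬ HasCrossing) →
      (mem (run detector t (initial G)) 0 ≡ 1 × ContainsP∅ G) ⊎ (mem (run detector t (initial G)) 0 ≡ 0 × ¬ ContainsP∅ G)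
    translate (inj₁ (is1 , crossing)) = inj₁ (trans (proj₂ final 0) is1 , hasCrossing⇒containsP∅ crossing)
    translate (inj₂ (is0 , none))     = inj₂ (trans (proj₂ final 0) is0 , none ∘ containsP∅⇒hasCrossing)

  detector-decides : Decides (100 * (n G + adjSize G) + 100)
  detector-decides = reaches⇒decides cost-bound (start needs4)
    where
    needs4 : HasCrossing → 4 ≤ length Ls
    needs4 = subst (4 ≤_) (sym (length-adjacencyLists G)) ∘ containsP∅⇒4≤n G ∘ hasCrossing⇒containsP∅
    cost-bound : startCost ≤ 100 * (n G + adjSize G) + 100
    cost-bound = subst₂ (λ a b → startCost ≤ 100 * (a + b) + 100)
      (length-adjacencyLists G) (sym adjSize≡length-concat) (startCost-bound Ls)

lemma10 : Σ Program λ P → Σ ℕ λ c → Σ ℕ λ d → DecidesWithin P c d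
lemma10 = detector , 100 , 100 , detector-decides
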